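{- Let $a\le b$ be positive integers and let $G$ be a finite simple graph whose vertex set is the disjoint union $A\cup B$ with $|A|=a$ and $|B|=b$, such that $A$ and $B$ each induce a complete graph in $G$ and $G$ contains no complete subgraph on $b+1$ vertices. Then there is a matching of non-edges of $G$ between $A$ and $B$ covering $A$, i.e. an injective map $\phi:A\to B$ such that $x\phi(x)$ is not an edge of $G$ for every $x\in A$. In particular, $G$ has at least $a$ non-edges. -}

module Defs where

open import Data.Nat using (ℕ)
open import Data.Fin using (Fin)
open import Relation.Nullary using (¬_; Dec)
open import Relation.Binary.PropositionalEquality using (_≡_)
open import Function.Definitions using (Injective)

record SimpleGraph (V : Set) : Set₁ where
  field
    Adj       : V → V → Set
    symmetric : ∀ {x y} → Adj x y → Adj y x
    loopless  : ∀ x → ¬ Adj x x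
    decAdj    : ∀ x y → Dec (Adj x y)

open SimpleGraph public

HasClique : {V : Set} → SimpleGraph V → ℕ → Set
HasClique {V} G k =
  Σ' (Fin k → V) λ f → Injective _≡_ _≡_ f × (∀ i j → ¬ i ≡ j → Adj G (f i) (f j))
  where
    open import Data.Product using (_×_) renaming (Σ to Σ')

module Submission where

-- The non-edges of G between A and B form a bipartite graph H; we need a
-- matching of H saturating A.  We prove Hall's theorem in König's form: a
-- bipartite graph R between Fin a and Fin b has an A-saturating matching or
-- an obstruction, i.e. S ⊆ A, T ⊆ B with no R-edges between them and
-- |S| + |T| > b.  For R = H an obstruction is a clique S ∪ T of G on more
-- than b vertices, which is excluded.  (The hypotheses 0 < a ≤ b are unused.)
--
-- Hall's theorem follows Rado's edge-deletion argument, by induction on the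
-- number of edges.  If no vertex of A has two neighbours, a matching or a Hall
-- violator is read off directly.  Otherwise some x has neighbours y₁ ≠ y₂ and
-- we recurse on R minus xy₁ and on R minus xy₂.  Matchings, and obstructions
-- avoiding x, lift to R; two obstructions containing x merge into one for R
-- by submodularity of cardinality.

open import Defs
open import Data.Nat using (ℕ; zero; suc; _≤_; _>_; _<_; _+_; _∸_; z≤n; s≤s; s≤s⁻¹; _≤?_)
open import Data.Nat.Properties
  using (≤-trans; ≤-refl; ≤-reflexive; <-≤-trans; +-suc; +-comm; +-mono-≤; +-monoˡ-<;
         +-cancelˡ-≤; +-monoˡ-≤; ≰⇒>; +-commutativeSemigroup; m+[n∸m]≡n; +-0-commutativeMonoid; module ≤-Reasoning)
open import Algebra.Properties.CommutativeSemigroup +-commutativeSemigroup using (interchange)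
open import Data.Fin using (Fin; zero; suc; splitAt; inject≤; punchIn)
open import Data.Fin.Properties
  using (_≟_; any?; all?; ¬∀⟶∃¬; suc-injective; inject≤-injective; punchInᵢ≢i; +↔⊎)
open import Data.Fin.Subset
  using (Subset; inside; outside; _∈_; _∉_; ⁅_⁆; ⊥; ∁; _∪_; _∩_; _-_; ∣_∣; Nonempty)
open import Data.Fin.Subset.Properties
  using (_∈?_; nonempty?; x∈⁅x⁆; x∈⁅y⁆⇒x≡y; ∣⊥∣≡0; ∣⁅x⁆∣≡1; ∣p∣≤n; ∣∁p∣≡n∸∣p∣; x∈∁p⇒x∉p;
         x∈p∪q⁺; x∈p∪q⁻; x∈p∩q⁺; x∈p∩q⁻; p─q⊆p; p─⊥≡p; x∈p∧x≢y⇒x∈p-y; x∈p⇒∣p-x∣<∣p∣)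
open import Data.Vec using ([]; _∷_; tabulate; here; there)
open import Data.Vec.Properties using ([]=⇒lookup; lookup⇒[]=; lookup∘tabulate)
open import Data.Vec.Functional using (updateAt; removeAt)
open import Data.Vec.Functional.Properties using (updateAt-updates; updateAt-minimal)
open import Data.Sum using (_⊎_; inj₁; inj₂)
import Data.Sum as Sum
open import Data.Sum.Properties using (inj₁-injective; inj₂-injective)
open import Data.Sum.Relation.Unary.All using (All; inj₁; inj₂)
open import Data.Product using (Σ; Σ-syntax; ∃; ∃₂; _×_; _,_; proj₁; proj₂; uncurry)
open import Data.Empty using (⊥-elim)
open import Function using (_∘_; Injection)
open import Function.Properties.Inverse using (Inverse⇒Injection)
open import Relation.Nullary using (¬_; Dec; yes; no; does; ¬?)
open import Relation.Nullary.Decidable using (dec-true; decidable-stable; _×-dec_)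
open import Relation.Binary.PropositionalEquality using (_≡_; _≢_; refl; sym; trans; cong; cong₂; subst; module ≡-Reasoning)
open import Function.Definitions using (Injective)

open import Algebra.Properties.CommutativeMonoid.Sum +-0-commutativeMonoid using (sum; sum-remove; sum-cong-≗)

x∈p⇒∣p∣≡1+∣p-x∣ : ∀ {n} {p : Subset n} {x : Fin n} → x ∈ p → ∣ p ∣ ≡ suc ∣ p - x ∣
x∈p⇒∣p∣≡1+∣p-x∣ {p = inside ∷ p}  here        = cong (suc ∘ ∣_∣) (sym (p─⊥≡p p))
x∈p⇒∣p∣≡1+∣p-x∣ {p = inside ∷ p}  (there x∈p) = cong suc (x∈p⇒∣p∣≡1+∣p-x∣ x∈p)
x∈p⇒∣p∣≡1+∣p-x∣ {p = outside ∷ p} (there x∈p) = x∈p⇒∣p∣≡1+∣p-x∣ x∈p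

x∈p-y⇒x≢y : ∀ {n} {p : Subset n} {x y : Fin n} → x ∈ p - y → x ≢ y
x∈p-y⇒x≢y {p = _ ∷ p} {suc x} (there x∈p-y) refl = x∈p-y⇒x≢y {p = p} x∈p-y refl

two-members⇒2≤∣p∣ : ∀ {n} {p : Subset n} {x y : Fin n} → x ∈ p → y ∈ p → x ≢ y → 2 ≤ ∣ p ∣
two-members⇒2≤∣p∣ {p = p} {x} {y} x∈p y∈p x≢y = begin
  2                        ≤⟨ s≤s (s≤s z≤n) ⟩
  suc (suc ∣ p - x - y ∣)  ≡⟨ cong suc (sym (x∈p⇒∣p∣≡1+∣p-x∣ y∈p-x)) ⟩
  suc ∣ p - x ∣            ≡⟨ sym (x∈p⇒∣p∣≡1+∣p-x∣ x∈p) ⟩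
  ∣ p ∣                    ∎
  where
  open ≤-Reasoning
  y∈p-x : y ∈ p - x
  y∈p-x = x∈p∧x≢y⇒x∈p-y y∈p (x≢y ∘ sym)

∣p∪q∣+∣p∩q∣≡∣p∣+∣q∣ : ∀ {n} (p q : Subset n) → ∣ p ∪ q ∣ + ∣ p ∩ q ∣ ≡ ∣ p ∣ + ∣ q ∣
∣p∪q∣+∣p∩q∣≡∣p∣+∣q∣ []            []            = refl
∣p∪q∣+∣p∩q∣≡∣p∣+∣q∣ (outside ∷ p) (outside ∷ q) = ∣p∪q∣+∣p∩q∣≡∣p∣+∣q∣ p q
∣p∪q∣+∣p∩q∣≡∣p∣+∣q∣ (inside ∷ p)  (outside ∷ q) = cong suc (∣p∪q∣+∣p∩q∣≡∣p∣+∣q∣ p q)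
∣p∪q∣+∣p∩q∣≡∣p∣+∣q∣ (outside ∷ p) (inside ∷ q)  =
  trans (cong suc (∣p∪q∣+∣p∩q∣≡∣p∣+∣q∣ p q)) (sym (+-suc ∣ p ∣ ∣ q ∣))
∣p∪q∣+∣p∩q∣≡∣p∣+∣q∣ (inside ∷ p)  (inside ∷ q)  = cong suc (begin
  ∣ p ∪ q ∣ + suc ∣ p ∩ q ∣  ≡⟨ +-suc ∣ p ∪ q ∣ ∣ p ∩ q ∣ ⟩
  suc (∣ p ∪ q ∣ + ∣ p ∩ q ∣) ≡⟨ cong suc (∣p∪q∣+∣p∩q∣≡∣p∣+∣q∣ p q) ⟩
  suc (∣ p ∣ + ∣ q ∣)         ≡⟨ sym (+-suc ∣ p ∣ ∣ q ∣) ⟩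
  ∣ p ∣ + suc ∣ q ∣           ∎)
  where open ≡-Reasoning

select : ∀ {n} {P : Fin n → Set} → (∀ i → Dec (P i)) → Subset n
select P? = tabulate (λ i → does (P? i))

∈-select⁺ : ∀ {n} {P : Fin n → Set} (P? : ∀ i → Dec (P i)) {i : Fin n} → P i → i ∈ select P?
∈-select⁺ P? {i} p = lookup⇒[]= i (select P?) (trans (lookup∘tabulate _ i) (dec-true (P? i) p))

∈-select⁻ : ∀ {n} {P : Fin n → Set} (P? : ∀ i → Dec (P i)) {i : Fin n} → i ∈ select P? → P i
∈-select⁻ P? {i} i∈ with P? i | trans (sym (lookup∘tabulate (λ j → does (P? j)) i)) ([]=⇒lookup i∈)
... | yes p | _ = p
... | no _  | ()

Enumeration : ∀ {n} → Subset n → Set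
Enumeration {n} p = Σ[ e ∈ (Fin ∣ p ∣ → Fin n) ] Injective _≡_ _≡_ e × (∀ i → e i ∈ p)

enumerate : ∀ {n} (p : Subset n) → Enumeration p
enumerate []            = (λ ()) , (λ {}) , (λ ())
enumerate (outside ∷ p) with enumerate p
... | e , e-inj , e∈p = suc ∘ e , e-inj ∘ suc-injective , there ∘ e∈p
enumerate (inside ∷ p)  with enumerate p
... | e , e-inj , e∈p = e′ , e′-inj , e′∈p
  where
  e′ : Fin (suc ∣ p ∣) → Fin _
  e′ zero    = zero
  e′ (suc i) = suc (e i)
  e′-inj : Injective _≡_ _≡_ e′
  e′-inj {zero}  {zero}  _  = refl
  e′-inj {suc i} {suc j} eq = cong suc (e-inj (suc-injective eq))
  e′∈p : ∀ i → e′ i ∈ inside ∷ p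
  e′∈p zero    = here
  e′∈p (suc i) = there (e∈p i)

Bipartite : ℕ → ℕ → Set
Bipartite a b = Fin a → Subset b

edges : ∀ {a b} → Bipartite a b → ℕ
edges R = sum (∣_∣ ∘ R)

removeEdge : ∀ {a b} → Bipartite a b → Fin a → Fin b → Bipartite a b
removeEdge R x y = updateAt R x (_- y)

module _ {a b} (R : Bipartite a b) (x : Fin a) (y : Fin b) where

  removeEdge-⊆ : ∀ {s t} → t ∈ removeEdge R x y s → t ∈ R s
  removeEdge-⊆ {s} t∈ with s ≟ x
  ... | yes refl = p─q⊆p (R x) ⁅ y ⁆ (subst (_ ∈_) (updateAt-updates x R) t∈)
  ... | no s≢x   = subst (_ ∈_) (updateAt-minimal s x R s≢x) t∈

  removeEdge-keeps : ∀ {s t} → t ∈ R s → s ≢ x ⊎ t ≢ y → t ∈ removeEdge R x y s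
  removeEdge-keeps {s} t∈Rs (inj₁ s≢x) = subst (_ ∈_) (sym (updateAt-minimal s x R s≢x)) t∈Rs
  removeEdge-keeps {s} t∈Rs (inj₂ t≢y) with s ≟ x
  ... | yes refl = subst (_ ∈_) (sym (updateAt-updates x R)) (x∈p∧x≢y⇒x∈p-y t∈Rs t≢y)
  ... | no s≢x   = removeEdge-keeps t∈Rs (inj₁ s≢x)

  removeEdge-lost : ∀ {s t} → t ∈ R s → t ∉ removeEdge R x y s → s ≡ x × t ≡ y
  removeEdge-lost {s} {t} t∈Rs t∉ =
    decidable-stable (s ≟ x) (λ s≢x → t∉ (removeEdge-keeps t∈Rs (inj₁ s≢x))) ,
    decidable-stable (t ≟ y) (λ t≢y → t∉ (removeEdge-keeps t∈Rs (inj₂ t≢y)))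

removeEdge-decreases : ∀ {a b} (R : Bipartite a b) {x y} → y ∈ R x → edges (removeEdge R x y) < edges R
removeEdge-decreases {suc a} R {x} {y} y∈Rx = begin-strict
  edges R′                                 ≡⟨ sum-remove {i = x} (∣_∣ ∘ R′) ⟩
  ∣ R′ x ∣ + sum (removeAt (∣_∣ ∘ R′) x)    ≡⟨ cong₂ _+_ (cong ∣_∣ (updateAt-updates x R)) (sum-cong-≗ others) ⟩
  ∣ R x - y ∣ + sum (removeAt (∣_∣ ∘ R) x)  <⟨ +-monoˡ-< _ (x∈p⇒∣p-x∣<∣p∣ y∈Rx) ⟩
  ∣ R x ∣ + sum (removeAt (∣_∣ ∘ R) x)      ≡⟨ sum-remove {i = x} (∣_∣ ∘ R) ⟨
  edges R                                  ∎
  where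
  open ≤-Reasoning
  R′ : Bipartite (suc a) _
  R′ = removeEdge R x y
  others : ∀ j → ∣ R′ (punchIn x j) ∣ ≡ ∣ R (punchIn x j) ∣
  others j = cong ∣_∣ (updateAt-minimal _ x R (punchInᵢ≢i x j))

record Matching {a b} (R : Bipartite a b) : Set where
  field
    φ           : Fin a → Fin b
    injective   : Injective _≡_ _≡_ φ
    along-edges : ∀ x → φ x ∈ R x

record Obstruction {a b} (R : Bipartite a b) : Set where
  field
    S           : Subset a
    T           : Subset b
    independent : ∀ {s t} → s ∈ S → t ∈ T → t ∉ R s
    large       : suc b ≤ ∣ S ∣ + ∣ T ∣

open Matching
open Obstruction

matching-mono : ∀ {a b} {R R′ : Bipartite a b} → (∀ {s t} → t ∈ R′ s → t ∈ R s) →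
                Matching R′ → Matching R
matching-mono R′⊆R M = record
  { φ = φ M ; injective = injective M ; along-edges = R′⊆R ∘ along-edges M }

obstruction-mono : ∀ {a b} {R R′ : Bipartite a b} (O : Obstruction R′) →
                   (∀ {s t} → s ∈ S O → t ∈ R s → t ∈ R′ s) → Obstruction R
obstruction-mono O R⊆R′ = record
  { S = S O ; T = T O ; large = large O
  ; independent = λ s∈S t∈T t∈Rs → independent O s∈S t∈T (R⊆R′ s∈S t∈Rs) }

hall-violator : ∀ {a b} (R : Bipartite a b) (S : Subset a) (N : Subset b) →
                (∀ {s t} → s ∈ S → t ∈ R s → t ∈ N) → ∣ N ∣ < ∣ S ∣ → Obstruction R
hall-violator {b = b} R S N nbhd⊆N ∣N∣<∣S∣ = record
  { S = S ; T = ∁ N ; large = large-S∁N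
  ; independent = λ s∈S t∈∁N t∈Rs → x∈∁p⇒x∉p t∈∁N (nbhd⊆N s∈S t∈Rs) }
  where
  open ≤-Reasoning
  large-S∁N : suc b ≤ ∣ S ∣ + ∣ ∁ N ∣
  large-S∁N = begin
    suc b                    ≡⟨ cong suc (m+[n∸m]≡n (∣p∣≤n N)) ⟨
    suc ∣ N ∣ + (b ∸ ∣ N ∣)  ≤⟨ +-mono-≤ ∣N∣<∣S∣ ≤-refl ⟩
    ∣ S ∣ + (b ∸ ∣ N ∣)      ≡⟨ cong (∣ S ∣ +_) (∣∁p∣≡n∸∣p∣ N) ⟨
    ∣ S ∣ + ∣ ∁ N ∣          ∎

isolated-obstruction : ∀ {a b} (R : Bipartite a b) (x : Fin a) → ¬ Nonempty (R x) → Obstruction R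
isolated-obstruction {b = b} R x isolated = hall-violator R ⁅ x ⁆ ⊥ nbhd⊆⊥ ∣⊥∣<∣⁅x⁆∣
  where
  nbhd⊆⊥ : ∀ {s t} → s ∈ ⁅ x ⁆ → t ∈ R s → t ∈ ⊥
  nbhd⊆⊥ s∈⁅x⁆ t∈Rs = ⊥-elim (isolated (_ , subst (λ s → _ ∈ R s) (x∈⁅y⁆⇒x≡y x s∈⁅x⁆) t∈Rs))
  ∣⊥∣<∣⁅x⁆∣ : ∣ ⊥ {n = b} ∣ < ∣ ⁅ x ⁆ ∣
  ∣⊥∣<∣⁅x⁆∣ = ≤-reflexive (trans (cong suc (∣⊥∣≡0 b)) (sym (∣⁅x⁆∣≡1 x)))

AtMostOneNeighbour : ∀ {a b} → Bipartite a b → Set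
AtMostOneNeighbour R = ∀ x {y y′} → y ∈ R x → y′ ∈ R x → y ≡ y′

shared-neighbour-obstruction : ∀ {a b} (R : Bipartite a b) → AtMostOneNeighbour R →
  ∀ {x₁ x₂ y} → x₁ ≢ x₂ → y ∈ R x₁ → y ∈ R x₂ → Obstruction R
shared-neighbour-obstruction R single {x₁} {x₂} {y} x₁≢x₂ y∈Rx₁ y∈Rx₂ =
  hall-violator R pair ⁅ y ⁆ nbhd⊆⁅y⁆ (subst (_< ∣ pair ∣) (sym (∣⁅x⁆∣≡1 y)) 2≤∣pair∣)
  where
  pair : Subset _
  pair = ⁅ x₁ ⁆ ∪ ⁅ x₂ ⁆
  2≤∣pair∣ : 2 ≤ ∣ pair ∣
  2≤∣pair∣ = two-members⇒2≤∣p∣ (x∈p∪q⁺ (inj₁ (x∈⁅x⁆ x₁))) (x∈p∪q⁺ (inj₂ (x∈⁅x⁆ x₂))) x₁≢x₂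
  only-y : ∀ {s t} → y ∈ R s → t ∈ R s → t ∈ ⁅ y ⁆
  only-y y∈Rs t∈Rs = subst (_∈ ⁅ y ⁆) (single _ y∈Rs t∈Rs) (x∈⁅x⁆ y)
  nbhd⊆⁅y⁆ : ∀ {s t} → s ∈ pair → t ∈ R s → t ∈ ⁅ y ⁆
  nbhd⊆⁅y⁆ s∈pair t∈Rs with x∈p∪q⁻ ⁅ x₁ ⁆ ⁅ x₂ ⁆ s∈pair
  ... | inj₁ s∈⁅x₁⁆ rewrite x∈⁅y⁆⇒x≡y x₁ s∈⁅x₁⁆ = only-y y∈Rx₁ t∈Rs
  ... | inj₂ s∈⁅x₂⁆ rewrite x∈⁅y⁆⇒x≡y x₂ s∈⁅x₂⁆ = only-y y∈Rx₂ t∈Rs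

injective-or-collision : ∀ {m n} (f : Fin m → Fin n) →
                         Injective _≡_ _≡_ f ⊎ ∃₂ λ i j → i ≢ j × f i ≡ f j
injective-or-collision f with any? (λ i → any? (λ j → ¬? (i ≟ j) ×-dec (f i ≟ f j)))
... | yes (i , j , i≢j , fi≡fj) = inj₂ (i , j , i≢j , fi≡fj)
... | no none = inj₁ λ {i} {j} fi≡fj → decidable-stable (i ≟ j) λ i≢j → none (i , j , i≢j , fi≡fj)

hall-base : ∀ {a b} (R : Bipartite a b) → AtMostOneNeighbour R → Matching R ⊎ Obstruction R
hall-base {a} R single with all? (nonempty? ∘ R)
... | no ¬all = inj₂ (uncurry (isolated-obstruction R) (¬∀⟶∃¬ a _ (nonempty? ∘ R) ¬all))
... | yes nbr with injective-or-collision (proj₁ ∘ nbr)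
...   | inj₁ nbr-inj = inj₁ record
  { φ = proj₁ ∘ nbr ; injective = nbr-inj ; along-edges = proj₂ ∘ nbr }
...   | inj₂ (x₁ , x₂ , x₁≢x₂ , same) = inj₂
  (shared-neighbour-obstruction R single x₁≢x₂ (proj₂ (nbr x₁)) (subst (_∈ R x₂) (sym same) (proj₂ (nbr x₂))))

one-exceeds : ∀ b X Y → suc b + suc b ≤ X + suc Y → suc b ≤ X ⊎ suc b ≤ Y
one-exceeds b X Y total≥ with suc b ≤? X
... | yes b<X = inj₁ b<X
... | no  b≮X = inj₂ (s≤s⁻¹ (+-cancelˡ-≤ b _ _ (begin
  b + suc (suc b)  ≡⟨ +-suc b (suc b) ⟩
  suc b + suc b    ≤⟨ total≥ ⟩
  X + suc Y        ≤⟨ +-monoˡ-≤ (suc Y) (s≤s⁻¹ (≰⇒> b≮X)) ⟩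
  b + suc Y        ∎)))
  where open ≤-Reasoning

-- Let O₁, O₂ be obstructions of R with the edges xy₁ resp. xy₂ deleted, and
-- x ∈ S₂.  An R-edge st with s ∈ S₁ and t ∈ T₁ ∩ T₂ would have to be the
-- deleted edge xy₁; but xy₁ survives in the second graph, joining x ∈ S₂ to
-- y₁ ∈ T₂.
cross-independent : ∀ {a b} {R : Bipartite a b} {x y₁ y₂} → y₁ ≢ y₂ →
  (O₁ : Obstruction (removeEdge R x y₁)) (O₂ : Obstruction (removeEdge R x y₂)) → x ∈ S O₂ →
  ∀ {s t} → s ∈ S O₁ → t ∈ T O₁ → t ∈ T O₂ → t ∉ R s
cross-independent {R = R} {x} {y₁} {y₂} y₁≢y₂ O₁ O₂ x∈S₂ s∈S₁ t∈T₁ t∈T₂ t∈Rs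
  with removeEdge-lost R x y₁ t∈Rs (independent O₁ s∈S₁ t∈T₁)
... | refl , refl = independent O₂ x∈S₂ t∈T₂ (removeEdge-keeps R x y₂ t∈Rs (inj₂ y₁≢y₂))

-- The merging step (submodularity): from obstructions O₁, O₂ as above with
-- x in both S₁ and S₂, either (S₁ ∪ S₂, T₁ ∩ T₂) or ((S₁ ∩ S₂) - x, T₁ ∪ T₂)
-- is an obstruction of R, since their sizes add up to |O₁| + |O₂| - 1.
module _ {a b} {R : Bipartite a b} {x : Fin a} {y₁ y₂ : Fin b} (y₁≢y₂ : y₁ ≢ y₂)
         (O₁ : Obstruction (removeEdge R x y₁)) (O₂ : Obstruction (removeEdge R x y₂))
         (x∈S₁ : x ∈ S O₁) (x∈S₂ : x ∈ S O₂) where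

  private
    S∪ S∩ S∩-x : Subset a
    S∪   = S O₁ ∪ S O₂
    S∩   = S O₁ ∩ S O₂
    S∩-x = S∩ - x
    T∪ T∩ : Subset b
    T∪   = T O₁ ∪ T O₂
    T∩   = T O₁ ∩ T O₂

    independent-∪ : ∀ {s t} → s ∈ S∪ → t ∈ T∩ → t ∉ R s
    independent-∪ s∈S∪ t∈T∩ with x∈p∪q⁻ (S O₁) (S O₂) s∈S∪ | x∈p∩q⁻ (T O₁) (T O₂) t∈T∩
    ... | inj₁ s∈S₁ | t∈T₁ , t∈T₂ = cross-independent y₁≢y₂ O₁ O₂ x∈S₂ s∈S₁ t∈T₁ t∈T₂
    ... | inj₂ s∈S₂ | t∈T₁ , t∈T₂ = cross-independent (y₁≢y₂ ∘ sym) O₂ O₁ x∈S₁ s∈S₂ t∈T₂ t∈T₁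

    -- Rows other than x are untouched by the deletions.
    independent-∩ : ∀ {s t} → s ∈ S∩-x → t ∈ T∪ → t ∉ R s
    independent-∩ {s} s∈S∩-x t∈T∪ t∈Rs with x∈p∩q⁻ (S O₁) (S O₂) (p─q⊆p S∩ ⁅ x ⁆ s∈S∩-x)
                                          | x∈p∪q⁻ (T O₁) (T O₂) t∈T∪
    ... | s∈S₁ , _ | inj₁ t∈T₁ = independent O₁ s∈S₁ t∈T₁ (removeEdge-keeps R x _ t∈Rs (inj₁ (x∈p-y⇒x≢y s∈S∩-x)))
    ... | _ , s∈S₂ | inj₂ t∈T₂ = independent O₂ s∈S₂ t∈T₂ (removeEdge-keeps R x _ t∈Rs (inj₁ (x∈p-y⇒x≢y s∈S∩-x)))

    total : (∣ S∪ ∣ + ∣ T∩ ∣) + suc (∣ S∩-x ∣ + ∣ T∪ ∣) ≡ (∣ S O₁ ∣ + ∣ T O₁ ∣) + (∣ S O₂ ∣ + ∣ T O₂ ∣)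
    total = begin
      (∣ S∪ ∣ + ∣ T∩ ∣) + (suc ∣ S∩-x ∣ + ∣ T∪ ∣)     ≡⟨ interchange ∣ S∪ ∣ _ _ _ ⟩
      (∣ S∪ ∣ + suc ∣ S∩-x ∣) + (∣ T∩ ∣ + ∣ T∪ ∣)     ≡⟨ cong₂ _+_ (cong (∣ S∪ ∣ +_) ∣S∩∣≡1+∣S∩-x∣) (+-comm ∣ T∪ ∣ _) ⟨
      (∣ S∪ ∣ + ∣ S∩ ∣) + (∣ T∪ ∣ + ∣ T∩ ∣)           ≡⟨ cong₂ _+_ (∣p∪q∣+∣p∩q∣≡∣p∣+∣q∣ (S O₁) (S O₂))
                                                             (∣p∪q∣+∣p∩q∣≡∣p∣+∣q∣ (T O₁) (T O₂)) ⟩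
      (∣ S O₁ ∣ + ∣ S O₂ ∣) + (∣ T O₁ ∣ + ∣ T O₂ ∣)   ≡⟨ interchange ∣ S O₁ ∣ _ _ _ ⟩
      (∣ S O₁ ∣ + ∣ T O₁ ∣) + (∣ S O₂ ∣ + ∣ T O₂ ∣)   ∎
      where
      open ≡-Reasoning
      ∣S∩∣≡1+∣S∩-x∣ : ∣ S∩ ∣ ≡ suc ∣ S∩-x ∣
      ∣S∩∣≡1+∣S∩-x∣ = x∈p⇒∣p∣≡1+∣p-x∣ (x∈p∩q⁺ (x∈S₁ , x∈S₂))

  merge-obstructions : Obstruction R
  merge-obstructions with one-exceeds b (∣ S∪ ∣ + ∣ T∩ ∣) (∣ S∩-x ∣ + ∣ T∪ ∣)
                            (≤-trans (+-mono-≤ (large O₁) (large O₂)) (≤-reflexive (sym total)))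
  ... | inj₁ large-∪ = record { S = S∪   ; T = T∩ ; independent = independent-∪ ; large = large-∪ }
  ... | inj₂ large-∩ = record { S = S∩-x ; T = T∪ ; independent = independent-∩ ; large = large-∩ }

obstruction-avoiding : ∀ {a b} {R : Bipartite a b} {x y} (O : Obstruction (removeEdge R x y)) →
                       x ∉ S O → Obstruction R
obstruction-avoiding {R = R} {x} {y} O x∉S =
  obstruction-mono O λ s∈S t∈Rs → removeEdge-keeps R x y t∈Rs (inj₁ λ { refl → x∉S s∈S })

hall-step : ∀ {a b} (R : Bipartite a b) {x y₁ y₂} → y₁ ≢ y₂ →
  Matching (removeEdge R x y₁) ⊎ Obstruction (removeEdge R x y₁) →
  Matching (removeEdge R x y₂) ⊎ Obstruction (removeEdge R x y₂) →
  Matching R ⊎ Obstruction R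
hall-step R {x} {y₁} _ (inj₁ M₁) _ = inj₁ (matching-mono (removeEdge-⊆ R x y₁) M₁)
hall-step R {x} {_} {y₂} _ _ (inj₁ M₂) = inj₁ (matching-mono (removeEdge-⊆ R x y₂) M₂)
hall-step R {x} y₁≢y₂ (inj₂ O₁) (inj₂ O₂) with x ∈? S O₁ | x ∈? S O₂
... | no x∉S₁  | _          = inj₂ (obstruction-avoiding O₁ x∉S₁)
... | _        | no x∉S₂    = inj₂ (obstruction-avoiding O₂ x∉S₂)
... | yes x∈S₁ | yes x∈S₂   = inj₂ (merge-obstructions y₁≢y₂ O₁ O₂ x∈S₁ x∈S₂)

Branching : ∀ {a b} → Bipartite a b → Set
Branching R = ∃ λ x → ∃₂ λ y₁ y₂ → y₁ ≢ y₂ × y₁ ∈ R x × y₂ ∈ R x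

branching? : ∀ {a b} (R : Bipartite a b) → AtMostOneNeighbour R ⊎ Branching R
branching? R with any? (λ x → any? (λ y₁ → any? (λ y₂ → ¬? (y₁ ≟ y₂) ×-dec (y₁ ∈? R x ×-dec y₂ ∈? R x))))
... | yes branch = inj₂ branch
... | no  none   = inj₁ λ x {y₁} {y₂} y₁∈Rx y₂∈Rx →
  decidable-stable (y₁ ≟ y₂) λ y₁≢y₂ → none (x , y₁ , y₂ , y₁≢y₂ , y₁∈Rx , y₂∈Rx)

hall-bounded : ∀ {a b} n (R : Bipartite a b) → edges R < n → Matching R ⊎ Obstruction R
hall-bounded (suc n) R (s≤s edges≤n) with branching? R
... | inj₁ single = hall-base R single
... | inj₂ (x , y₁ , y₂ , y₁≢y₂ , y₁∈Rx , y₂∈Rx) = hall-step R y₁≢y₂ (delete y₁∈Rx) (delete y₂∈Rx)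
  where
  delete : ∀ {y} → y ∈ R x → Matching (removeEdge R x y) ⊎ Obstruction (removeEdge R x y)
  delete y∈Rx = hall-bounded n (removeEdge R x _) (<-≤-trans (removeEdge-decreases R y∈Rx) edges≤n)

hall : ∀ {a b} (R : Bipartite a b) → Matching R ⊎ Obstruction R
hall R = hall-bounded (suc (edges R)) R ≤-refl

map-injective : ∀ {A B C D : Set} {f : A → C} {g : B → D} →
                Injective _≡_ _≡_ f → Injective _≡_ _≡_ g → Injective _≡_ _≡_ (Sum.map f g)
map-injective f-inj g-inj {inj₁ _} {inj₁ _} eq = cong inj₁ (f-inj (inj₁-injective eq))
map-injective f-inj g-inj {inj₂ _} {inj₂ _} eq = cong inj₂ (g-inj (inj₂-injective eq))

clique-≤ : ∀ {V : Set} (G : SimpleGraph V) {k m} (e : Fin k → V) → Injective _≡_ _≡_ e →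
           (∀ i j → i ≢ j → Adj G (e i) (e j)) → m ≤ k → HasClique G m
clique-≤ G e e-inj e-adj m≤k = e ∘ inject , inject-inj ∘ e-inj , λ i j i≢j → e-adj _ _ (i≢j ∘ inject-inj)
  where
  inject : Fin _ → Fin _
  inject i = inject≤ i m≤k
  inject-inj : Injective _≡_ _≡_ inject
  inject-inj {i} {j} = inject≤-injective m≤k m≤k i j

nonAdjacency : ∀ {a b} → SimpleGraph (Fin a ⊎ Fin b) → Bipartite a b
nonAdjacency G x = select (λ y → ¬? (decAdj G (inj₁ x) (inj₂ y)))

obstruction⇒clique : ∀ {a b} (G : SimpleGraph (Fin a ⊎ Fin b)) →
  (∀ (i j : Fin a) → i ≢ j → Adj G (inj₁ i) (inj₁ j)) →
  (∀ (i j : Fin b) → i ≢ j → Adj G (inj₂ i) (inj₂ j)) →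
  Obstruction (nonAdjacency G) → HasClique G (suc b)
obstruction⇒clique G cliqueA cliqueB O = clique-≤ G e e-inj e-adj (large O)
  where
  InST : Fin _ ⊎ Fin _ → Set
  InST = All (_∈ S O) (_∈ T O)

  enumS : Enumeration (S O)
  enumS = enumerate (S O)
  enumT : Enumeration (T O)
  enumT = enumerate (T O)

  e : Fin (∣ S O ∣ + ∣ T O ∣) → Fin _ ⊎ Fin _
  e = Sum.map (proj₁ enumS) (proj₁ enumT) ∘ splitAt ∣ S O ∣
  e-inj : Injective _≡_ _≡_ e
  e-inj = Injection.injective (Inverse⇒Injection (+↔⊎ {∣ S O ∣} {∣ T O ∣}))
        ∘ map-injective (proj₁ (proj₂ enumS)) (proj₁ (proj₂ enumT))
  e∈ST : ∀ k → InST (e k)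
  e∈ST k with splitAt ∣ S O ∣ k
  ... | inj₁ i = inj₁ (proj₂ (proj₂ enumS) i)
  ... | inj₂ j = inj₂ (proj₂ (proj₂ enumT) j)

  -- Edges between S and T: the non-edges of G between them are edges of
  -- the non-adjacency graph, and there are none.
  across : ∀ {s t} → s ∈ S O → t ∈ T O → Adj G (inj₁ s) (inj₂ t)
  across s∈S t∈T = decidable-stable (decAdj G _ _) λ ¬adj →
    independent O s∈S t∈T (∈-select⁺ (λ y → ¬? (decAdj G _ (inj₂ y))) ¬adj)

  adjacent : ∀ {u v} → InST u → InST v → u ≢ v → Adj G u v
  adjacent (inj₁ _)   (inj₁ _)   u≢v = cliqueA _ _ (u≢v ∘ cong inj₁)
  adjacent (inj₂ _)   (inj₂ _)   u≢v = cliqueB _ _ (u≢v ∘ cong inj₂)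
  adjacent (inj₁ s∈S) (inj₂ t∈T) _   = across s∈S t∈T
  adjacent (inj₂ t∈T) (inj₁ s∈S) _   = symmetric G (across s∈S t∈T)

  e-adj : ∀ i j → i ≢ j → Adj G (e i) (e j)
  e-adj i j i≢j = adjacent (e∈ST i) (e∈ST j) (i≢j ∘ e-inj)

lemma2 : (a b : ℕ) → a > 0 → a ≤ b → (G : SimpleGraph (Fin a ⊎ Fin b)) →
         (∀ (i j : Fin a) → ¬ i ≡ j → Adj G (inj₁ i) (inj₁ j)) →
         (∀ (i j : Fin b) → ¬ i ≡ j → Adj G (inj₂ i) (inj₂ j)) →
         ¬ HasClique G (suc b) →
         Σ (Fin a → Fin b) λ φ → Injective _≡_ _≡_ φ × (∀ x → ¬ Adj G (inj₁ x) (inj₂ (φ x)))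
lemma2 a b _ _ G cliqueA cliqueB no-clique with hall (nonAdjacency G)
... | inj₁ M = φ M , injective M , λ x → ∈-select⁻ (λ y → ¬? (decAdj G (inj₁ x) (inj₂ y))) (along-edges M x)
... | inj₂ O = ⊥-elim (no-clique (obstruction⇒clique G cliqueA cliqueB O))
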